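{- Let $p$ be an odd prime and let $b_0,b_1,b_2,\ldots\in\mathbb{Q}_p$ be such that for all $n\geq 0$: \[v_p(b_{3n+1})<0,\quad v_p(b_{3n+2})=0,\quad v_p(b_{3n+3})=0,\quad v_p(b_{3n+3}b_{3n+2}+1)=0.\] Define $B_0=1$, $B_1=b_1$ and $B_n=b_nB_{n-1}+B_{n-2}$ for $n\geq 2$. Then for all $n\geq 1$, \[v_p(B_{3n-2})=v_p(B_{3n-1})=v_p(B_{3n})>v_p(B_{3n+1}).\]
   Context: $v_p$ denotes the $p$-adic valuation on $\mathbb{Q}_p$. The $B_n$ are the denominators of the convergents $A_n/B_n$ of the continued fraction $[b_0,b_1,b_2,\ldots]$. -}

module Defs where

open import Level using (Level)
open import Data.Nat as ℕ using (ℕ; zero; suc)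
open import Data.Integer as ℤ using (ℤ)
open import Data.Product using (Σ; _×_; _,_)
open import Relation.Nullary using (¬_)
open import Relation.Binary.PropositionalEquality using (_≡_)
open import Algebra.Bundles using (CommutativeRing)

-- ℤ ∪ {∞}: value group of a discrete valuation together with v(0) = ∞
data ℤ∞ : Set where
  fin : ℤ → ℤ∞
  ∞   : ℤ∞

infixl 6 _+∞_
_+∞_ : ℤ∞ → ℤ∞ → ℤ∞
fin a +∞ fin b = fin (a ℤ.+ b)
fin _ +∞ ∞     = ∞
∞     +∞ _     = ∞

infix 4 _≤∞_ _<∞_
data _≤∞_ : ℤ∞ → ℤ∞ → Set where
  fin≤fin : ∀ {a b} → a ℤ.≤ b → fin a ≤∞ fin b
  _≤∞∞    : ∀ x → x ≤∞ ∞

data _<∞_ : ℤ∞ → ℤ∞ → Set where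
  fin<fin : ∀ {a b} → a ℤ.< b → fin a <∞ fin b
  fin<∞   : ∀ {a} → fin a <∞ ∞

min∞ : ℤ∞ → ℤ∞ → ℤ∞
min∞ (fin a) (fin b) = fin (a ℤ.⊓ b)
min∞ (fin a) ∞       = fin a
min∞ ∞       y       = y

module _ {c ℓ} (K : CommutativeRing c ℓ) where
  open CommutativeRing K

  IsField : Set (c Level.⊔ ℓ)
  IsField = ∀ x → ¬ (x ≈ 0#) → Σ Carrier λ y → x * y ≈ 1#

  ℕ→K : ℕ → Carrier
  ℕ→K zero    = 0#
  ℕ→K (suc n) = 1# + ℕ→K n

  record IsValuation (v : Carrier → ℤ∞) : Set (c Level.⊔ ℓ) where
    field
      v-cong : ∀ {x y} → x ≈ y → v x ≡ v y
      v-∞⇒0  : ∀ x → v x ≡ ∞ → x ≈ 0#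
      v-0    : v 0# ≡ ∞
      v-*    : ∀ x y → v (x * y) ≡ v x +∞ v y
      v-+    : ∀ x y → min∞ (v x) (v y) ≤∞ v (x + y)

  -- v extends the p-adic valuation: normalized by v(p) = 1
  IsPAdicValuation : ℕ → (Carrier → ℤ∞) → Set (c Level.⊔ ℓ)
  IsPAdicValuation p v = IsValuation v × v (ℕ→K p) ≡ fin (ℤ.+ 1)

  B : (ℕ → Carrier) → ℕ → Carrier
  B b zero          = 1#
  B b (suc zero)    = b 1
  B b (suc (suc n)) = b (suc (suc n)) * B b (suc n) + B b n

-- If v(B_{k+1}) < v(B_k), the ultrametric inequality is strict in each of the next three steps
-- of the recurrence: b_{k+2} is a unit, so v(B_{k+2}) = v(B_{k+1}); unfolding twice,
-- B_{k+3} = (b_{k+3} b_{k+2} + 1) B_{k+1} + b_{k+3} B_k with a unit coefficient in front of B_{k+1},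
-- so v(B_{k+3}) = v(B_{k+1}); and v(b_{k+4}) < 0 makes b_{k+4} B_{k+3} the dominant term of B_{k+4},
-- giving v(B_{k+4}) < v(B_{k+3}). This restores the hypothesis three indices later, and
-- v(B_1) = v(b_1) < 0 = v(B_0) starts the induction.
module Submission where

open import Defs
open import Data.Nat using (ℕ; zero; suc; _+_; _*_; _∸_; _≤_)
import Data.Nat.Properties as ℕ
open import Data.Nat.Primality using (Prime)
open import Data.Integer as ℤ using (+_)
import Data.Integer.Properties as ℤ
open import Data.Product using (_×_; _,_)
open import Data.Sum using (_⊎_; inj₁; inj₂)
open import Relation.Nullary using (¬_; contradiction)
open import Relation.Binary.PropositionalEquality as ≡ using (_≡_; refl)
open import Algebra.Bundles using (CommutativeRing)
import Algebra.Properties.Ring as RingProperties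
import Relation.Binary.Reasoning.Setoid as SetoidReasoning
open import Algebra.Properties.AbelianGroup ℤ.+-0-abelianGroup using (identityʳ-unique)

fin-injective : ∀ {a b} → fin a ≡ fin b → a ≡ b
fin-injective refl = refl

+∞-identityˡ : ∀ X → fin (+ 0) +∞ X ≡ X
+∞-identityˡ (fin a) = ≡.cong fin (ℤ.+-identityˡ a)
+∞-identityˡ ∞       = refl

+∞-cancel-identity : ∀ {a X} → fin a ≡ fin a +∞ X → X ≡ fin (+ 0)
+∞-cancel-identity {a} {fin x} eq = ≡.cong fin (identityʳ-unique a x (≡.sym (fin-injective eq)))

double≡0⇒≡0 : ∀ {X} → X +∞ X ≡ fin (+ 0) → X ≡ fin (+ 0)
double≡0⇒≡0 {fin (+ 0)} _ = refl

<∞⇒≤∞ : ∀ {X Y} → X <∞ Y → X ≤∞ Y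
<∞⇒≤∞ (fin<fin a<b) = fin≤fin (ℤ.<⇒≤ a<b)
<∞⇒≤∞ fin<∞         = _ ≤∞∞

<∞⇒≱∞ : ∀ {X Y} → X <∞ Y → ¬ (Y ≤∞ X)
<∞⇒≱∞ (fin<fin a<b) (fin≤fin b≤a) = ℤ.<⇒≱ a<b b≤a

≤∞-antisym : ∀ {X Y} → X ≤∞ Y → Y ≤∞ X → X ≡ Y
≤∞-antisym (fin≤fin a≤b) (fin≤fin b≤a) = ≡.cong fin (ℤ.≤-antisym a≤b b≤a)
≤∞-antisym (_ ≤∞∞)       (.∞ ≤∞∞)      = refl

min∞-sel : ∀ X Y → min∞ X Y ≡ X ⊎ min∞ X Y ≡ Y
min∞-sel (fin a) (fin b) with ℤ.⊓-sel a b
... | inj₁ eq = inj₁ (≡.cong fin eq)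
... | inj₂ eq = inj₂ (≡.cong fin eq)
min∞-sel (fin a) ∞ = inj₁ refl
min∞-sel ∞       Y = inj₂ refl

X≤∞Y⇒min∞≡X : ∀ {X Y} → X ≤∞ Y → min∞ X Y ≡ X
X≤∞Y⇒min∞≡X (fin≤fin a≤b) = ≡.cong fin (ℤ.i≤j⇒i⊓j≡i a≤b)
X≤∞Y⇒min∞≡X (fin a ≤∞∞)   = refl
X≤∞Y⇒min∞≡X (∞ ≤∞∞)       = refl

-- The ultrametric "isosceles" argument in ℤ∞: Z plays v(x + y), and the two bounds are the
-- ultrametric inequality for x + y and for x = (x + y) + (- y).
min∞-squeeze : ∀ {X Y Z} → X <∞ Y → min∞ X Y ≤∞ Z → min∞ Z Y ≤∞ X → Z ≡ X
min∞-squeeze {X} {Y} {Z} X<Y X∧Y≤Z Z∧Y≤X = ≤∞-antisym Z≤X X≤Z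
  where
  X≤Z : X ≤∞ Z
  X≤Z = ≡.subst (_≤∞ Z) (X≤∞Y⇒min∞≡X (<∞⇒≤∞ X<Y)) X∧Y≤Z
  Z≤X : Z ≤∞ X
  Z≤X with min∞-sel Z Y
  ... | inj₁ eq = ≡.subst (_≤∞ X) eq Z∧Y≤X
  ... | inj₂ eq = contradiction (≡.subst (_≤∞ X) eq Z∧Y≤X) (<∞⇒≱∞ X<Y)

+∞-<-negativeˡ : ∀ {X Y Z} → X <∞ fin (+ 0) → Y <∞ Z → X +∞ Y <∞ Y
+∞-<-negativeˡ {fin x} {fin y} (fin<fin x<0) _ =
  fin<fin (≡.subst (x ℤ.+ y ℤ.<_) (ℤ.+-identityˡ y) (ℤ.+-monoˡ-< y x<0))

module _ {c ℓ} (K : CommutativeRing c ℓ) where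
  open CommutativeRing K renaming (_+_ to _⊕_; _*_ to _·_)

  v-1≡0 : ∀ {v} → IsValuation K v → ∀ {x a} → v x ≡ fin a → v 1# ≡ fin (+ 0)
  v-1≡0 {v} isValuation {x} v-x≡a = +∞-cancel-identity (begin
    fin _           ≡⟨ ≡.sym v-x≡a ⟩
    v x             ≡⟨ v-cong (sym (*-identityʳ x)) ⟩
    v (x · 1#)      ≡⟨ v-* x 1# ⟩
    v x +∞ v 1#     ≡⟨ ≡.cong (_+∞ v 1#) v-x≡a ⟩
    fin _ +∞ v 1#   ∎)
    where open IsValuation isValuation
          open ≡.≡-Reasoning

module Valuation {c ℓ} (K : CommutativeRing c ℓ) {v : CommutativeRing.Carrier K → ℤ∞}
                 (isValuation : IsValuation K v) (v-1≡0 : v (CommutativeRing.1# K) ≡ fin (+ 0)) where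
  open CommutativeRing K renaming (_+_ to _⊕_; _*_ to _·_)
  open IsValuation isValuation
  open RingProperties ring using (-1*x≈-x; -‿involutive)

  v-*-unitˡ : ∀ {u} y → v u ≡ fin (+ 0) → v (u · y) ≡ v y
  v-*-unitˡ {u} y v-u≡0 = ≡.trans (v-* u y) (≡.trans (≡.cong (_+∞ v y) v-u≡0) (+∞-identityˡ (v y)))

  v-[-1]≡0 : v (- 1#) ≡ fin (+ 0)
  v-[-1]≡0 = double≡0⇒≡0 (begin
    v (- 1#) +∞ v (- 1#)  ≡⟨ ≡.sym (v-* (- 1#) (- 1#)) ⟩
    v (- 1# · - 1#)       ≡⟨ v-cong (trans (-1*x≈-x (- 1#)) (-‿involutive 1#)) ⟩
    v 1#                  ≡⟨ v-1≡0 ⟩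
    fin (+ 0)             ∎)
    where open ≡.≡-Reasoning

  v-neg : ∀ y → v (- y) ≡ v y
  v-neg y = ≡.trans (v-cong (sym (-1*x≈-x y))) (v-*-unitˡ y v-[-1]≡0)

  v-+-strict : ∀ x y → v x <∞ v y → v (x ⊕ y) ≡ v x
  v-+-strict x y vx<vy = min∞-squeeze vx<vy (v-+ x y) v[x+y]∧vy≤vx
    where
    x+y-y≈x : (x ⊕ y) ⊕ - y ≈ x
    x+y-y≈x = trans (+-assoc x y (- y)) (trans (+-congˡ (-‿inverseʳ y)) (+-identityʳ x))
    v[x+y]∧vy≤vx : min∞ (v (x ⊕ y)) (v y) ≤∞ v x
    v[x+y]∧vy≤vx = ≡.subst₂ (λ Y X → min∞ (v (x ⊕ y)) Y ≤∞ X)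
                            (v-neg y) (v-cong x+y-y≈x) (v-+ (x ⊕ y) (- y))

module Continuants {c ℓ} (K : CommutativeRing c ℓ) {v : CommutativeRing.Carrier K → ℤ∞}
                   (isValuation : IsValuation K v) (v-1≡0 : v (CommutativeRing.1# K) ≡ fin (+ 0))
                   (b : ℕ → CommutativeRing.Carrier K) where
  open CommutativeRing K renaming (_+_ to _⊕_; _*_ to _·_)
  open IsValuation isValuation using (v-cong; v-*)
  open Valuation K isValuation v-1≡0

  B-unfold₂ : ∀ k → B K b (3 + k) ≈ (b (3 + k) · b (2 + k) ⊕ 1#) · B K b (1 + k) ⊕ b (3 + k) · B K b k
  B-unfold₂ k = begin
    b₃ · (b₂ · X₁ ⊕ X₀) ⊕ X₁          ≈⟨ +-congʳ (distribˡ b₃ (b₂ · X₁) X₀) ⟩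
    (b₃ · (b₂ · X₁) ⊕ b₃ · X₀) ⊕ X₁   ≈⟨ +-congʳ (+-congʳ (sym (*-assoc b₃ b₂ X₁))) ⟩
    ((b₃ · b₂) · X₁ ⊕ b₃ · X₀) ⊕ X₁   ≈⟨ +-assoc _ _ _ ⟩
    (b₃ · b₂) · X₁ ⊕ (b₃ · X₀ ⊕ X₁)   ≈⟨ +-congˡ (+-comm _ _) ⟩
    (b₃ · b₂) · X₁ ⊕ (X₁ ⊕ b₃ · X₀)   ≈⟨ sym (+-assoc _ _ _) ⟩
    ((b₃ · b₂) · X₁ ⊕ X₁) ⊕ b₃ · X₀   ≈⟨ +-congʳ (+-congˡ (sym (*-identityˡ X₁))) ⟩
    ((b₃ · b₂) · X₁ ⊕ 1# · X₁) ⊕ b₃ · X₀ ≈⟨ +-congʳ (sym (distribʳ X₁ (b₃ · b₂) 1#)) ⟩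
    (b₃ · b₂ ⊕ 1#) · X₁ ⊕ b₃ · X₀     ∎
    where
    open SetoidReasoning setoid
    b₂ = b (2 + k)
    b₃ = b (3 + k)
    X₀ = B K b k
    X₁ = B K b (1 + k)

  valuation-block : ∀ k
    → v (b (2 + k)) ≡ fin (+ 0)
    → v (b (3 + k)) ≡ fin (+ 0)
    → v (b (3 + k) · b (2 + k) ⊕ 1#) ≡ fin (+ 0)
    → v (b (4 + k)) <∞ fin (+ 0)
    → v (B K b (1 + k)) <∞ v (B K b k)
    → (v (B K b (1 + k)) ≡ v (B K b (2 + k)))
      × (v (B K b (2 + k)) ≡ v (B K b (3 + k)))
      × (v (B K b (4 + k)) <∞ v (B K b (3 + k)))
  valuation-block k v-b₂ v-b₃ v-b₃b₂+1 v-b₄<0 vX₁<vX₀ =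
    ≡.sym vX₂≡vX₁ , ≡.trans vX₂≡vX₁ (≡.sym vX₃≡vX₁) , vX₄<vX₃
    where
    X₀ = B K b k
    X₁ = B K b (1 + k)
    X₃ = B K b (3 + k)

    vX₂≡vX₁ : v (B K b (2 + k)) ≡ v X₁
    vX₂≡vX₁ = ≡.trans (v-+-strict _ X₀ (≡.subst (_<∞ v X₀) (≡.sym v[b₂X₁]≡vX₁) vX₁<vX₀)) v[b₂X₁]≡vX₁
      where v[b₂X₁]≡vX₁ = v-*-unitˡ X₁ v-b₂

    vX₃≡vX₁ : v X₃ ≡ v X₁
    vX₃≡vX₁ = ≡.trans (v-cong (B-unfold₂ k))
      (≡.trans (v-+-strict _ _ (≡.subst₂ _<∞_ (≡.sym v[uX₁]≡vX₁) (≡.sym (v-*-unitˡ X₀ v-b₃)) vX₁<vX₀))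
               v[uX₁]≡vX₁)
      where v[uX₁]≡vX₁ = v-*-unitˡ X₁ v-b₃b₂+1

    vX₄<vX₃ : v (B K b (4 + k)) <∞ v X₃
    vX₄<vX₃ = ≡.subst (_<∞ v X₃) (≡.sym vX₄≡v[b₄X₃]) v[b₄X₃]<vX₃
      where
      v[b₄X₃]<vX₃ : v (b (4 + k) · X₃) <∞ v X₃
      v[b₄X₃]<vX₃ = ≡.subst (_<∞ v X₃) (≡.sym (v-* _ X₃))
        (+∞-<-negativeˡ v-b₄<0 (≡.subst (_<∞ v X₀) (≡.sym vX₃≡vX₁) vX₁<vX₀))
      vX₄≡v[b₄X₃] : v (B K b (4 + k)) ≡ v (b (4 + k) · X₃)
      vX₄≡v[b₄X₃] = v-+-strict _ _
        (≡.subst (v (b (4 + k) · X₃) <∞_) (≡.sym (≡.trans vX₂≡vX₁ (≡.sym vX₃≡vX₁))) v[b₄X₃]<vX₃)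

  ValuationPattern : Set
  ValuationPattern = ∀ n → (v (b (3 * n + 1)) <∞ fin (+ 0))
                         × (v (b (3 * n + 2)) ≡ fin (+ 0))
                         × (v (b (3 * n + 3)) ≡ fin (+ 0))
                         × (v (b (3 * n + 3) · b (3 * n + 2) ⊕ 1#) ≡ fin (+ 0))

  module _ (b-pattern : ValuationPattern) where

    valuation-block₃ : ∀ m → v (B K b (1 + 3 * m)) <∞ v (B K b (3 * m))
      → (v (B K b (1 + 3 * m)) ≡ v (B K b (2 + 3 * m)))
        × (v (B K b (2 + 3 * m)) ≡ v (B K b (3 + 3 * m)))
        × (v (B K b (4 + 3 * m)) <∞ v (B K b (3 + 3 * m)))
    valuation-block₃ m with b-pattern m | b-pattern (suc m)
    ... | _ , v-b₂ , v-b₃ , v-b₃b₂+1 | v-b₄<0 , _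
      rewrite ℕ.+-comm (3 * m) 2 | ℕ.+-comm (3 * m) 3 | ℕ.+-comm (3 * suc m) 1 | ℕ.*-suc 3 m
      = valuation-block (3 * m) v-b₂ v-b₃ v-b₃b₂+1 v-b₄<0

    v-B-dominant : ∀ m → v (B K b (1 + 3 * m)) <∞ v (B K b (3 * m))
    v-B-dominant zero with b-pattern 0
    ... | v-b₁<0 , _ = ≡.subst (v (b 1) <∞_) (≡.sym v-1≡0) v-b₁<0
    v-B-dominant (suc m) with valuation-block₃ m (v-B-dominant m)
    ... | _ , _ , vB₄<vB₃ = ≡.subst (λ i → v (B K b (1 + i)) <∞ v (B K b i)) (≡.sym (ℕ.*-suc 3 m)) vB₄<vB₃

    ValuationPlateauAt : ℕ → Set
    ValuationPlateauAt t = (v (B K b (t ∸ 2)) ≡ v (B K b (t ∸ 1)))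
                 × (v (B K b (t ∸ 1)) ≡ v (B K b t))
                 × (v (B K b (t + 1)) <∞ v (B K b t))

    v-B-pattern : ∀ n → 1 ≤ n → ValuationPlateauAt (3 * n)
    v-B-pattern (suc m) _ with valuation-block₃ m (v-B-dominant m)
    ... | vB₁≡vB₂ , vB₂≡vB₃ , vB₄<vB₃ = ≡.subst ValuationPlateauAt (≡.sym (ℕ.*-suc 3 m))
      (vB₁≡vB₂ , vB₂≡vB₃ , ≡.subst (λ i → v (B K b i) <∞ v (B K b (3 + 3 * m))) (ℕ.+-comm 1 (3 + 3 * m)) vB₄<vB₃)

theorem4p1 : ∀ {c ℓ} (p : ℕ) → Prime p → ¬ (p ≡ 2)
    → (K : CommutativeRing c ℓ) → IsField K
    → (v : CommutativeRing.Carrier K → ℤ∞) → IsPAdicValuation K p v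
    → (b : ℕ → CommutativeRing.Carrier K)
    → (∀ n → (v (b (3 * n + 1)) <∞ fin (ℤ.+ 0))
           × (v (b (3 * n + 2)) ≡ fin (ℤ.+ 0))
           × (v (b (3 * n + 3)) ≡ fin (ℤ.+ 0))
           × (v (CommutativeRing._+_ K (CommutativeRing._*_ K (b (3 * n + 3)) (b (3 * n + 2))) (CommutativeRing.1# K)) ≡ fin (ℤ.+ 0)))
    → ∀ n → 1 ≤ n
    → (v (B K b (3 * n ∸ 2)) ≡ v (B K b (3 * n ∸ 1)))
      × (v (B K b (3 * n ∸ 1)) ≡ v (B K b (3 * n)))
      × (v (B K b (3 * n + 1)) <∞ v (B K b (3 * n)))
theorem4p1 p _ _ K _ v (isValuation , v-p≡1) b b-pattern =
  v-B-pattern b-pattern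
  where open Continuants K isValuation (v-1≡0 K isValuation v-p≡1) b
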